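{- For each integer $n\geq 0$ and every $x\in\mathbb{C}$, \[ \sum_{k=0}^n \binom{n}{k} C_{2(n-k)}(x)\,\bigl(12x\sqrt{9x^2-1}\bigr)^{k} E_{k}(x) = \bigl( 18x^2 - 1 + 6x(2x-1)\sqrt{9x^2-1}\bigr)^{n}, \] where $\sqrt{9x^2-1}$ denotes a fixed square root of $9x^2-1$ (the same one on both sides).
   Context: Lucas-balancing polynomials $C_n(x)$ are defined by $C_0(x)=1$, $C_1(x)=3x$, $C_n(x)=6xC_{n-1}(x)-C_{n-2}(x)$ for $n\geq 2$. Euler polynomials $E_n(x)$ are defined by $\sum_{n\geq 0} E_n(x)\frac{z^n}{n!}=\frac{2e^{xz}}{e^z+1}$. -}

module Defs where

open import Algebra.Bundles using (CommutativeRing)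
open import Data.Nat using (ℕ; zero; suc)
open import Data.Nat.Combinatorics using (_C_)

-- Everything is developed over an arbitrary commutative ring R together with
-- a chosen element `half` (intended: the inverse of 2, see the theorem).
module WithRing {c ℓ} (R : CommutativeRing c ℓ) (half : CommutativeRing.Carrier R) where
  open CommutativeRing R

  ⟦_⟧ : ℕ → Carrier
  ⟦ zero ⟧  = 0#
  ⟦ suc n ⟧ = 1# + ⟦ n ⟧

  infixr 8 _^_
  _^_ : Carrier → ℕ → Carrier
  a ^ zero  = 1#
  a ^ suc n = a * (a ^ n)

  sumTo : ℕ → (ℕ → Carrier) → Carrier
  sumTo zero    f = 0#
  sumTo (suc m) f = sumTo m f + f m

  -- Lucas-balancing polynomials: C_0 = 1, C_1 = 3x, C_n = 6x C_{n-1} - C_{n-2}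
  LB : ℕ → Carrier → Carrier
  LB zero          x = 1#
  LB (suc zero)    x = ⟦ 3 ⟧ * x
  LB (suc (suc n)) x = ⟦ 6 ⟧ * x * LB (suc n) x - LB n x

  -- Comparing coefficients of z^n/n! in
  --   (e^z + 1) Σ E_n(x) z^n/n! = 2 e^{xz}
  -- gives  Σ_{k≤n} binom(n,k) E_k(x) + E_n(x) = 2 x^n, i.e.
  --   E_n(x) = x^n - (1/2) Σ_{k<n} binom(n,k) E_k(x).
  mutual
    Euler : ℕ → Carrier → Carrier
    Euler n x = x ^ n - half * partialE n n x

    partialE : ℕ → ℕ → Carrier → Carrier
    partialE n zero    x = 0#
    partialE n (suc m) x = partialE n m x + ⟦ n C m ⟧ * Euler m x

  lhs6 : ℕ → Carrier → Carrier → Carrier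
  lhs6 n x s = sumTo (suc n) (λ k →
    ⟦ n C k ⟧ * LB (2 Data.Nat.* (n Data.Nat.∸ k)) x * ((⟦ 12 ⟧ * x * s) ^ k) * Euler k x)

  rhs6 : ℕ → Carrier → Carrier → Carrier
  rhs6 n x s = (⟦ 18 ⟧ * (x * x) - 1# + ⟦ 6 ⟧ * x * (⟦ 2 ⟧ * x - 1#) * s) ^ n

{-# OPTIONS --safe #-}
-- With α = 3x + s and β = 3x − s we have α + β = 6x and αβ = 1, so 2 Cₙ = αⁿ + βⁿ and
-- 2 C₂ₘ = Aᵐ + Bᵐ for A = α², B = β². Since A = B + T with T = 12xs, the left side is
-- ½ ((B + T + T E)ⁿ + (B + T E)ⁿ) read umbrally (Eᵏ ↦ Eₖ(x)). The recurrence defining the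
-- Euler polynomials says (E + 1)ᵐ + Eᵐ = 2xᵐ, which collapses this to (B + T x)ⁿ, and
-- B + T x = 18x² − 1 + 6x(2x − 1)s.
module Submission where

open import Algebra.Bundles using (CommutativeRing)
open import Data.Nat as ℕ using (ℕ; zero; suc; z≤n; s≤s; _∸_)
import Data.Nat.Properties as ℕₚ
open import Data.Nat.Combinatorics using (_C_; nCn≡1; k>n⇒nCk≡0; nCk+nC[k+1]≡[n+1]C[k+1])
open import Data.Integer as ℤ using (ℤ; +_; -[1+_]; _⊖_; _◃_)
import Data.Integer.Properties as ℤₚ
open import Data.Sign as Sign using (Sign)
open import Data.Maybe using (Maybe; just; nothing)
open import Relation.Nullary using (yes; no)
import Relation.Binary.PropositionalEquality as ≡
open import Function using (_∘_)
open import Level using (Level)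
import Relation.Binary.Reasoning.Setoid as SetoidReasoning
open import Defs

module IntegerSolver {c ℓ} (R : CommutativeRing c ℓ) where
  open CommutativeRing R
  open import Algebra.Properties.Semiring.Mult semiring using (_×_; ×-homo-+; ×1-homo-*)
  open import Algebra.Properties.Ring ring using (-1*x≈-x; -‿involutive; -0#≈0#)
  open import Algebra.Properties.AbelianGroup +-abelianGroup using (⁻¹-∙-comm)
  open import Algebra.Properties.CommutativeSemigroup +-commutativeSemigroup
    using () renaming (interchange to +-interchange)
  open import Algebra.Properties.CommutativeSemigroup *-commutativeSemigroup
    using () renaming (interchange to *-interchange)
  open import Algebra.Solver.Ring.AlmostCommutativeRing
    using (fromCommutativeRing; _-Raw-AlmostCommutative⟶_)
  open SetoidReasoning setoid

  fromℕ : ℕ → Carrier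
  fromℕ n = n × 1#

  fromℤ : ℤ → Carrier
  fromℤ (+ n)    = fromℕ n
  fromℤ -[1+ n ] = - fromℕ (suc n)

  fromSign : Sign → Carrier
  fromSign Sign.+ = 1#
  fromSign Sign.- = - 1#

  fromSign-* : ∀ s t → fromSign (s Sign.* t) ≈ fromSign s * fromSign t
  fromSign-* Sign.+ t      = sym (*-identityˡ _)
  fromSign-* Sign.- Sign.+ = sym (*-identityʳ _)
  fromSign-* Sign.- Sign.- = sym (trans (-1*x≈-x _) (-‿involutive _))

  x+y-[x+z]≈y-z : ∀ x y z → (x + y) - (x + z) ≈ y - z
  x+y-[x+z]≈y-z x y z = begin
    (x + y) + - (x + z)   ≈⟨ +-congˡ (sym (⁻¹-∙-comm x z)) ⟩
    (x + y) + (- x + - z) ≈⟨ +-interchange x y (- x) (- z) ⟩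
    (x - x) + (y - z)     ≈⟨ +-congʳ (-‿inverseʳ x) ⟩
    0# + (y - z)          ≈⟨ +-identityˡ _ ⟩
    y - z                 ∎

  fromℤ-⊖ : ∀ m n → fromℤ (m ⊖ n) ≈ fromℕ m - fromℕ n
  fromℤ-⊖ m       zero    rewrite ℤₚ.⊖-≥ {m} {0} z≤n =
    sym (trans (+-congˡ -0#≈0#) (+-identityʳ _))
  fromℤ-⊖ zero    (suc n) rewrite ℤₚ.⊖-≤ {0} {suc n} z≤n = sym (+-identityˡ _)
  fromℤ-⊖ (suc m) (suc n) rewrite ℤₚ.[1+m]⊖[1+n]≡m⊖n m n =
    trans (fromℤ-⊖ m n) (sym (x+y-[x+z]≈y-z 1# (fromℕ m) (fromℕ n)))

  fromℤ-+ : ∀ i j → fromℤ (i ℤ.+ j) ≈ fromℤ i + fromℤ j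
  fromℤ-+ -[1+ m ] -[1+ n ] = begin
    - fromℕ (suc (suc (m ℕ.+ n)))     ≈⟨ -‿cong (reflexive (≡.cong (λ k → fromℕ (suc k)) (≡.sym (ℕₚ.+-suc m n)))) ⟩
    - fromℕ (suc m ℕ.+ suc n)         ≈⟨ -‿cong (×-homo-+ 1# (suc m) (suc n)) ⟩
    - (fromℕ (suc m) + fromℕ (suc n)) ≈⟨ ⁻¹-∙-comm _ _ ⟨
    - fromℕ (suc m) + - fromℕ (suc n) ∎
  fromℤ-+ -[1+ m ] (+ n)    = trans (fromℤ-⊖ n (suc m)) (+-comm _ _)
  fromℤ-+ (+ m)    -[1+ n ] = fromℤ-⊖ m (suc n)
  fromℤ-+ (+ m)    (+ n)    = ×-homo-+ 1# m n

  fromℤ-◃ : ∀ s n → fromℤ (s ◃ n) ≈ fromSign s * fromℕ n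
  fromℤ-◃ s      zero    = sym (zeroʳ _)
  fromℤ-◃ Sign.+ (suc n) = sym (*-identityˡ _)
  fromℤ-◃ Sign.- (suc n) = sym (-1*x≈-x _)

  fromℤ-signAbs : ∀ i → fromℤ i ≈ fromSign (ℤ.sign i) * fromℕ ℤ.∣ i ∣
  fromℤ-signAbs i = trans (reflexive (≡.cong fromℤ (≡.sym (ℤₚ.◃-inverse i)))) (fromℤ-◃ (ℤ.sign i) ℤ.∣ i ∣)

  fromℤ-* : ∀ i j → fromℤ (i ℤ.* j) ≈ fromℤ i * fromℤ j
  fromℤ-* i j = begin
    fromℤ (i ℤ.* j)
      ≈⟨ fromℤ-◃ (ℤ.sign i Sign.* ℤ.sign j) (ℤ.∣ i ∣ ℕ.* ℤ.∣ j ∣) ⟩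
    fromSign (ℤ.sign i Sign.* ℤ.sign j) * fromℕ (ℤ.∣ i ∣ ℕ.* ℤ.∣ j ∣)
      ≈⟨ *-cong (fromSign-* (ℤ.sign i) (ℤ.sign j)) (×1-homo-* ℤ.∣ i ∣ ℤ.∣ j ∣) ⟩
    (fromSign (ℤ.sign i) * fromSign (ℤ.sign j)) * (fromℕ ℤ.∣ i ∣ * fromℕ ℤ.∣ j ∣)
      ≈⟨ *-interchange _ _ _ _ ⟩
    (fromSign (ℤ.sign i) * fromℕ ℤ.∣ i ∣) * (fromSign (ℤ.sign j) * fromℕ ℤ.∣ j ∣)
      ≈⟨ *-cong (fromℤ-signAbs i) (fromℤ-signAbs j) ⟨
    fromℤ i * fromℤ j ∎

  fromℤ-neg : ∀ i → fromℤ (ℤ.- i) ≈ - fromℤ i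
  fromℤ-neg -[1+ n ]  = sym (-‿involutive _)
  fromℤ-neg (+ zero)  = sym -0#≈0#
  fromℤ-neg (+ suc n) = refl

  -- fromℤ with + 1 sent to 1# rather than 1# + 0#: solver constants then unfold to exactly
  -- the numerals 1#, 1# + (1# + 0#), … of the statement.
  coefficient : ℤ → Carrier
  coefficient (+ 1) = 1#
  coefficient i     = fromℤ i

  coefficient≈fromℤ : ∀ i → coefficient i ≈ fromℤ i
  coefficient≈fromℤ (+ zero)        = refl
  coefficient≈fromℤ (+ suc zero)    = sym (+-identityʳ 1#)
  coefficient≈fromℤ (+ suc (suc n)) = refl
  coefficient≈fromℤ -[1+ n ]        = refl

  private
    homomorphism : ℤ.+-*-rawRing -Raw-AlmostCommutative⟶ fromCommutativeRing R
    homomorphism = record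
      { ⟦_⟧    = coefficient
      ; +-homo = λ i j → trans (coefficient≈fromℤ (i ℤ.+ j))
          (trans (fromℤ-+ i j) (sym (+-cong (coefficient≈fromℤ i) (coefficient≈fromℤ j))))
      ; *-homo = λ i j → trans (coefficient≈fromℤ (i ℤ.* j))
          (trans (fromℤ-* i j) (sym (*-cong (coefficient≈fromℤ i) (coefficient≈fromℤ j))))
      ; -‿homo = λ i → trans (coefficient≈fromℤ (ℤ.- i))
          (trans (fromℤ-neg i) (sym (-‿cong (coefficient≈fromℤ i))))
      ; 0-homo = refl
      ; 1-homo = refl
      }

    coefficient-≟ : ∀ i j → Maybe (coefficient i ≈ coefficient j)
    coefficient-≟ i j with i ℤ.≟ j
    ... | yes ≡.refl = just refl
    ... | no _       = nothing

  open import Algebra.Solver.Ring ℤ.+-*-rawRing (fromCommutativeRing R) homomorphism coefficient-≟ public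
    using (solve; _:=_; con; _:+_; _:*_; _:-_)

module Development {c ℓ} (R : CommutativeRing c ℓ) (half : CommutativeRing.Carrier R) where
  open CommutativeRing R
  open WithRing R half
  open IntegerSolver R using (solve; _:=_; con; _:+_; _:*_; _:-_)
  open SetoidReasoning setoid
  open import Algebra.Properties.CommutativeSemigroup +-commutativeSemigroup
    using () renaming (interchange to +-interchange)
  open import Algebra.Properties.CommutativeSemigroup *-commutativeSemigroup
    using (x∙yz≈y∙xz)

  two : Carrier
  two = 1# + 1#

  ⟦+⟧ : ∀ m n → ⟦ m ℕ.+ n ⟧ ≈ ⟦ m ⟧ + ⟦ n ⟧
  ⟦+⟧ zero    n = sym (+-identityˡ _)
  ⟦+⟧ (suc m) n = trans (+-congˡ (⟦+⟧ m n)) (sym (+-assoc _ _ _))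

  sumTo-cong : ∀ m {f g : ℕ → Carrier} → (∀ k → f k ≈ g k) → sumTo m f ≈ sumTo m g
  sumTo-cong zero    f≈g = refl
  sumTo-cong (suc m) f≈g = +-cong (sumTo-cong m f≈g) (f≈g m)

  sumTo-+ : ∀ m f g → sumTo m (λ k → f k + g k) ≈ sumTo m f + sumTo m g
  sumTo-+ zero    f g = sym (+-identityʳ 0#)
  sumTo-+ (suc m) f g = trans (+-congʳ (sumTo-+ m f g)) (+-interchange _ _ _ _)

  sumTo-*ˡ : ∀ m a f → sumTo m (λ k → a * f k) ≈ a * sumTo m f
  sumTo-*ˡ zero    a f = sym (zeroʳ a)
  sumTo-*ˡ (suc m) a f = trans (+-congʳ (sumTo-*ˡ m a f)) (sym (distribˡ a _ _))

  sumTo-suc : ∀ m f → sumTo (suc m) f ≈ f 0 + sumTo m (f ∘ suc)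
  sumTo-suc zero    f = +-comm _ _
  sumTo-suc (suc m) f = trans (+-congʳ (sumTo-suc m f)) (+-assoc _ _ _)

  ^-cong : ∀ {a b} n → a ≈ b → a ^ n ≈ b ^ n
  ^-cong zero    a≈b = refl
  ^-cong (suc n) a≈b = *-cong a≈b (^-cong n a≈b)

  ^-double : ∀ a m → a ^ (2 ℕ.* m) ≈ (a * a) ^ m
  ^-double a zero    = refl
  ^-double a (suc m) rewrite ℕₚ.+-suc m (m ℕ.+ 0) =
    trans (*-congˡ (*-congˡ (^-double a m))) (sym (*-assoc a a _))

  1^n≈1 : ∀ n → 1# ^ n ≈ 1#
  1^n≈1 zero    = refl
  1^n≈1 (suc n) = trans (*-identityˡ _) (1^n≈1 n)

  binomialTerm : ℕ → (ℕ → Carrier) → Carrier → Carrier → ℕ → Carrier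
  binomialTerm n u a t k = ⟦ n C k ⟧ * a ^ (n ∸ k) * t ^ k * u k

  -- The umbral power (a + t U)ⁿ, with Uᵏ read as u k.
  binomialSum : ℕ → (ℕ → Carrier) → Carrier → Carrier → Carrier
  binomialSum n u a t = sumTo (suc n) (binomialTerm n u a t)

  binomialSum-zero : ∀ u a t → binomialSum 0 u a t ≈ u 0
  binomialSum-zero u a t =
    solve 1 (λ u₀ → con (+ 0) :+ (con (+ 1) :+ con (+ 0)) :* con (+ 1) :* con (+ 1) :* u₀ := u₀) refl (u 0)

  binomialSum-congᵘ : ∀ n {u v} a t → (∀ k → u k ≈ v k) → binomialSum n u a t ≈ binomialSum n v a t
  binomialSum-congᵘ n a t u≈v = sumTo-cong (suc n) (λ k → *-congˡ (u≈v k))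

  binomialSum-congᵃ : ∀ n u {a b} t → a ≈ b → binomialSum n u a t ≈ binomialSum n u b t
  binomialSum-congᵃ n u t a≈b = sumTo-cong (suc n) (λ k → *-congʳ (*-congʳ (*-congˡ (^-cong (n ∸ k) a≈b))))

  binomialSum-+ᵘ : ∀ n u v a t →
    binomialSum n (λ k → u k + v k) a t ≈ binomialSum n u a t + binomialSum n v a t
  binomialSum-+ᵘ n u v a t = trans (sumTo-cong (suc n) (λ k → distribˡ _ _ _)) (sumTo-+ (suc n) _ _)

  binomialSum-*ᵘ : ∀ n b u a t → binomialSum n (λ k → b * u k) a t ≈ b * binomialSum n u a t
  binomialSum-*ᵘ n b u a t = trans (sumTo-cong (suc n) (λ k → x∙yz≈y∙xz _ b (u k))) (sumTo-*ˡ (suc n) b _)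

  binomialTerm-vanishes : ∀ {n k} u a t → n ℕ.< k → binomialTerm n u a t k ≈ 0#
  binomialTerm-vanishes u a t n<k rewrite k>n⇒nCk≡0 n<k =
    trans (*-congʳ (trans (*-congʳ (zeroˡ _)) (zeroˡ _))) (zeroˡ _)

  binomialTerm-zero : ∀ n u a t → binomialTerm (suc n) u a t 0 ≈ a * binomialTerm n u a t 0
  binomialTerm-zero n u a t =
    solve 5 (λ c a p t u → c :* (a :* p) :* t :* u := a :* (c :* p :* t :* u)) refl _ a _ _ _

  C-power-shift : ∀ n j a → ⟦ n C suc j ⟧ * a ^ (n ∸ j) ≈ a * (⟦ n C suc j ⟧ * a ^ (n ∸ suc j))
  C-power-shift n j a with j ℕ.<? n
  ... | yes j<n rewrite ℕₚ.+-∸-assoc 1 j<n = x∙yz≈y∙xz _ a _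
  ... | no  j≮n rewrite k>n⇒nCk≡0 (s≤s (ℕₚ.≮⇒≥ j≮n)) =
    trans (zeroˡ _) (sym (trans (*-congˡ (zeroˡ _)) (zeroʳ a)))

  binomialTerm-suc : ∀ n u a t j → binomialTerm (suc n) u a t (suc j)
                     ≈ t * binomialTerm n (u ∘ suc) a t j + a * binomialTerm n u a t (suc j)
  binomialTerm-suc n u a t j = begin
    ⟦ suc n C suc j ⟧ * a ^ (n ∸ j) * (t * t ^ j) * u (suc j)
      ≈⟨ *-congʳ (*-congʳ (*-congʳ (reflexive (≡.cong ⟦_⟧ (≡.sym (nCk+nC[k+1]≡[n+1]C[k+1] n j)))))) ⟩
    ⟦ n C j ℕ.+ n C suc j ⟧ * a ^ (n ∸ j) * (t * t ^ j) * u (suc j)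
      ≈⟨ *-congʳ (*-congʳ (*-congʳ (⟦+⟧ (n C j) (n C suc j)))) ⟩
    (⟦ n C j ⟧ + ⟦ n C suc j ⟧) * a ^ (n ∸ j) * (t * t ^ j) * u (suc j)
      ≈⟨ solve 6 (λ c c′ p t tʲ u → (c :+ c′) :* p :* (t :* tʲ) :* u
                                   := t :* (c :* p :* tʲ :* u) :+ c′ :* p :* (t :* tʲ) :* u)
                 refl _ _ _ t _ _ ⟩
    t * binomialTerm n (u ∘ suc) a t j + ⟦ n C suc j ⟧ * a ^ (n ∸ j) * (t * t ^ j) * u (suc j)
      ≈⟨ +-congˡ (*-congʳ (*-congʳ (C-power-shift n j a))) ⟩
    t * binomialTerm n (u ∘ suc) a t j + a * (⟦ n C suc j ⟧ * a ^ (n ∸ suc j)) * (t * t ^ j) * u (suc j)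
      ≈⟨ +-congˡ (solve 4 (λ a q r u → a :* q :* r :* u := a :* (q :* r :* u)) refl a _ _ _) ⟩
    t * binomialTerm n (u ∘ suc) a t j + a * binomialTerm n u a t (suc j) ∎

  binomialSum-suc : ∀ n u a t →
    binomialSum (suc n) u a t ≈ a * binomialSum n u a t + t * binomialSum n (u ∘ suc) a t
  binomialSum-suc n u a t = begin
    sumTo (suc (suc n)) (binomialTerm (suc n) u a t)
      ≈⟨ sumTo-suc (suc n) _ ⟩
    binomialTerm (suc n) u a t 0 + sumTo (suc n) (binomialTerm (suc n) u a t ∘ suc)
      ≈⟨ +-cong (binomialTerm-zero n u a t) (sumTo-cong (suc n) (binomialTerm-suc n u a t)) ⟩
    a * T 0 + sumTo (suc n) (λ j → t * binomialTerm n (u ∘ suc) a t j + a * T (suc j))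
      ≈⟨ +-congˡ (trans (sumTo-+ (suc n) _ _) (+-cong (sumTo-*ˡ (suc n) t _) (sumTo-*ˡ (suc n) a _))) ⟩
    a * T 0 + (t * binomialSum n (u ∘ suc) a t + a * sumTo (suc n) (T ∘ suc))
      ≈⟨ solve 4 (λ a T₀ tH S → a :* T₀ :+ (tH :+ a :* S) := a :* (T₀ :+ S) :+ tH) refl a _ _ _ ⟩
    a * (T 0 + sumTo (suc n) (T ∘ suc)) + t * binomialSum n (u ∘ suc) a t
      ≈⟨ +-congʳ (*-congˡ (sym (sumTo-suc (suc n) T))) ⟩
    a * (sumTo (suc n) T + T (suc n)) + t * binomialSum n (u ∘ suc) a t
      ≈⟨ +-congʳ (*-congˡ (trans (+-congˡ (binomialTerm-vanishes u a t (ℕₚ.n<1+n n))) (+-identityʳ _))) ⟩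
    a * binomialSum n u a t + t * binomialSum n (u ∘ suc) a t ∎
    where
    T : ℕ → Carrier
    T = binomialTerm n u a t

  binomialTransform : (ℕ → Carrier) → ℕ → Carrier
  binomialTransform u m = binomialSum m u 1# 1#

  binomialTransform-suc : ∀ u m →
    binomialTransform u (suc m) ≈ binomialTransform u m + binomialTransform (u ∘ suc) m
  binomialTransform-suc u m = trans (binomialSum-suc m u 1# 1#) (+-cong (*-identityˡ _) (*-identityˡ _))

  -- (b + t + t U)ⁿ = (b + t (U + 1))ⁿ, and (U + 1)ᵐ is binomialTransform u m.
  binomialSum-shift : ∀ n u b t → binomialSum n u (b + t) t ≈ binomialSum n (binomialTransform u) b t
  binomialSum-shift zero    u b t =
    trans (binomialSum-zero u (b + t) t) (sym (trans (binomialSum-zero (binomialTransform u) b t) (binomialSum-zero u 1# 1#)))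
  binomialSum-shift (suc n) u b t = begin
    binomialSum (suc n) u (b + t) t
      ≈⟨ binomialSum-suc n u (b + t) t ⟩
    (b + t) * binomialSum n u (b + t) t + t * binomialSum n (u ∘ suc) (b + t) t
      ≈⟨ +-cong (*-congˡ (binomialSum-shift n u b t)) (*-congˡ (binomialSum-shift n (u ∘ suc) b t)) ⟩
    (b + t) * X + t * Y
      ≈⟨ solve 4 (λ b t X Y → (b :+ t) :* X :+ t :* Y := b :* X :+ t :* (X :+ Y)) refl b t X Y ⟩
    b * X + t * (X + Y)
      ≈⟨ +-congˡ (*-congˡ (sym (binomialSum-+ᵘ n _ _ b t))) ⟩
    b * X + t * binomialSum n (λ k → binomialTransform u k + binomialTransform (u ∘ suc) k) b t
      ≈⟨ +-congˡ (*-congˡ (binomialSum-congᵘ n b t (λ k → sym (binomialTransform-suc u k)))) ⟩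
    b * X + t * binomialSum n (binomialTransform u ∘ suc) b t
      ≈⟨ binomialSum-suc n _ b t ⟨
    binomialSum (suc n) (binomialTransform u) b t ∎
    where
    X Y : Carrier
    X = binomialSum n (binomialTransform u) b t
    Y = binomialSum n (binomialTransform (u ∘ suc)) b t

  binomialSum-powers : ∀ x n b t → binomialSum n (x ^_) b t ≈ (b + t * x) ^ n
  binomialSum-powers x zero    b t = binomialSum-zero (x ^_) b t
  binomialSum-powers x (suc n) b t = begin
    binomialSum (suc n) (x ^_) b t
      ≈⟨ binomialSum-suc n _ b t ⟩
    b * binomialSum n (x ^_) b t + t * binomialSum n (λ k → x * x ^ k) b t
      ≈⟨ +-congˡ (*-congˡ (binomialSum-*ᵘ n x _ b t)) ⟩
    b * P + t * (x * P)
      ≈⟨ solve 4 (λ b t x P → b :* P :+ t :* (x :* P) := (b :+ t :* x) :* P) refl b t x P ⟩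
    (b + t * x) * P
      ≈⟨ *-congˡ (binomialSum-powers x n b t) ⟩
    (b + t * x) ^ suc n ∎
    where
    P : Carrier
    P = binomialSum n (x ^_) b t

  module EulerPolynomials (x : Carrier) where
    E : ℕ → Carrier
    E k = Euler k x

    sumTo≈partialE : ∀ m j → sumTo j (λ k → ⟦ m C k ⟧ * E k) ≈ partialE m j x
    sumTo≈partialE m zero    = refl
    sumTo≈partialE m (suc j) = +-congʳ (sumTo≈partialE m j)

    binomialTransform-Euler : ∀ m → binomialTransform E m ≈ partialE m m x + E m
    binomialTransform-Euler m = begin
      binomialTransform E m
        ≈⟨ sumTo-cong (suc m) (λ k → *-congʳ (trans (*-cong (*-congˡ (1^n≈1 (m ∸ k))) (1^n≈1 k))
                                                   (trans (*-identityʳ _) (*-identityʳ _)))) ⟩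
      sumTo m (λ k → ⟦ m C k ⟧ * E k) + ⟦ m C m ⟧ * E m
        ≈⟨ +-cong (sumTo≈partialE m m) (reflexive (≡.cong (λ c → ⟦ c ⟧ * E m) (nCn≡1 m))) ⟩
      partialE m m x + (1# + 0#) * E m
        ≈⟨ +-congˡ (trans (*-congʳ (+-identityʳ 1#)) (*-identityˡ _)) ⟩
      partialE m m x + E m ∎

    module _ (half*two≈1 : half * two ≈ 1#) where
      binomialTransform-Euler-recurrence : ∀ m → binomialTransform E m + E m ≈ two * x ^ m
      binomialTransform-Euler-recurrence m = begin
        binomialTransform E m + E m
          ≈⟨ +-congʳ (binomialTransform-Euler m) ⟩
        (P + (x ^ m - half * P)) + (x ^ m - half * P)
          ≈⟨ solve 3 (λ P xᵐ h → (P :+ (xᵐ :- h :* P)) :+ (xᵐ :- h :* P)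
                                  := (con (+ 1) :+ con (+ 1)) :* xᵐ
                                     :+ (con (+ 1) :- h :* (con (+ 1) :+ con (+ 1))) :* P)
                     refl P (x ^ m) half ⟩
        two * x ^ m + (1# - half * two) * P
          ≈⟨ +-congˡ (*-congʳ (trans (+-congˡ (-‿cong half*two≈1)) (-‿inverseʳ 1#))) ⟩
        two * x ^ m + 0# * P
          ≈⟨ trans (+-congˡ (zeroˡ P)) (+-identityʳ _) ⟩
        two * x ^ m ∎
        where
        P : Carrier
        P = partialE m m x

      binomialSum-Euler : ∀ n b t → binomialSum n E (b + t) t + binomialSum n E b t ≈ two * (b + t * x) ^ n
      binomialSum-Euler n b t = begin
        binomialSum n E (b + t) t + binomialSum n E b t
          ≈⟨ +-congʳ (binomialSum-shift n E b t) ⟩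
        binomialSum n (binomialTransform E) b t + binomialSum n E b t
          ≈⟨ binomialSum-+ᵘ n _ _ b t ⟨
        binomialSum n (λ k → binomialTransform E k + E k) b t
          ≈⟨ binomialSum-congᵘ n b t binomialTransform-Euler-recurrence ⟩
        binomialSum n (λ k → two * x ^ k) b t
          ≈⟨ binomialSum-*ᵘ n two _ b t ⟩
        two * binomialSum n (x ^_) b t
          ≈⟨ *-congˡ (binomialSum-powers x n b t) ⟩
        two * (b + t * x) ^ n ∎

  module Balancing (half*two≈1 : half * two ≈ 1#) (x s : Carrier)
                   (s²≈9x²-1 : s * s ≈ ⟦ 9 ⟧ * (x * x) - 1#) where
    open EulerPolynomials x

    α β A B T : Carrier
    α = ⟦ 3 ⟧ * x + s
    β = ⟦ 3 ⟧ * x - s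
    A = α * α
    B = β * β
    T = ⟦ 12 ⟧ * x * s

    α+β≈6x : α + β ≈ ⟦ 6 ⟧ * x
    α+β≈6x = solve 2 (λ x s → (con (+ 3) :* x :+ s) :+ (con (+ 3) :* x :- s) := con (+ 6) :* x) refl x s

    αβ≈1 : α * β ≈ 1#
    αβ≈1 = begin
      α * β
        ≈⟨ solve 2 (λ x s → (con (+ 3) :* x :+ s) :* (con (+ 3) :* x :- s) := con (+ 9) :* (x :* x) :- s :* s)
                   refl x s ⟩
      ⟦ 9 ⟧ * (x * x) - s * s
        ≈⟨ +-congˡ (-‿cong s²≈9x²-1) ⟩
      ⟦ 9 ⟧ * (x * x) - (⟦ 9 ⟧ * (x * x) - 1#)
        ≈⟨ solve 1 (λ y → y :- (y :- con (+ 1)) := con (+ 1)) refl _ ⟩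
      1# ∎

    LB-Binet : ∀ n → LB n x * two ≈ α ^ n + β ^ n
    LB-Binet zero          = *-identityˡ two
    LB-Binet (suc zero)    =
      solve 2 (λ x s → con (+ 3) :* x :* (con (+ 1) :+ con (+ 1))
                       := (con (+ 3) :* x :+ s) :* con (+ 1) :+ (con (+ 3) :* x :- s) :* con (+ 1))
              refl x s
    LB-Binet (suc (suc n)) = begin
      (⟦ 6 ⟧ * x * LB (suc n) x - LB n x) * two
        ≈⟨ solve 3 (λ c L₁ L₀ → (c :* L₁ :- L₀) :* (con (+ 1) :+ con (+ 1))
                               := c :* (L₁ :* (con (+ 1) :+ con (+ 1))) :- L₀ :* (con (+ 1) :+ con (+ 1)))
                   refl (⟦ 6 ⟧ * x) _ _ ⟩
      ⟦ 6 ⟧ * x * (LB (suc n) x * two) - LB n x * two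
        ≈⟨ +-cong (*-cong (sym α+β≈6x) (LB-Binet (suc n)))
                  (-‿cong (trans (LB-Binet n) (sym (trans (*-congʳ αβ≈1) (*-identityˡ _))))) ⟩
      (α + β) * (α ^ suc n + β ^ suc n) - α * β * (α ^ n + β ^ n)
        ≈⟨ solve 4 (λ α β p q → (α :+ β) :* (α :* p :+ β :* q) :- α :* β :* (p :+ q)
                               := α :* (α :* p) :+ β :* (β :* q)) refl α β (α ^ n) (β ^ n) ⟩
      α ^ suc (suc n) + β ^ suc (suc n) ∎

    half-cancelˡ : ∀ y → half * (two * y) ≈ y
    half-cancelˡ y = trans (sym (*-assoc half two y)) (trans (*-congʳ half*two≈1) (*-identityˡ y))

    LB-even : ∀ m → LB (2 ℕ.* m) x ≈ half * (A ^ m + B ^ m)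
    LB-even m = begin
      LB (2 ℕ.* m) x                       ≈⟨ half-cancelˡ _ ⟨
      half * (two * LB (2 ℕ.* m) x)        ≈⟨ *-congˡ (trans (*-comm two _) (LB-Binet (2 ℕ.* m))) ⟩
      half * (α ^ (2 ℕ.* m) + β ^ (2 ℕ.* m)) ≈⟨ *-congˡ (+-cong (^-double α m) (^-double β m)) ⟩
      half * (A ^ m + B ^ m)               ∎

    A≈B+T : A ≈ B + T
    A≈B+T = solve 2 (λ x s → (con (+ 3) :* x :+ s) :* (con (+ 3) :* x :+ s)
                             := (con (+ 3) :* x :- s) :* (con (+ 3) :* x :- s) :+ con (+ 12) :* x :* s)
                    refl x s

    B+Tx≈base : B + T * x ≈ ⟦ 18 ⟧ * (x * x) - 1# + ⟦ 6 ⟧ * x * (⟦ 2 ⟧ * x - 1#) * s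
    B+Tx≈base = begin
      B + T * x
        ≈⟨ solve 2 (λ x s → (con (+ 3) :* x :- s) :* (con (+ 3) :* x :- s) :+ con (+ 12) :* x :* s :* x
                            := con (+ 18) :* (x :* x) :- con (+ 1)
                               :+ con (+ 6) :* x :* (con (+ 2) :* x :- con (+ 1)) :* s
                               :+ (s :* s :- (con (+ 9) :* (x :* x) :- con (+ 1))))
                   refl x s ⟩
      base + (s * s - (⟦ 9 ⟧ * (x * x) - 1#))
        ≈⟨ +-congˡ (trans (+-congʳ s²≈9x²-1) (-‿inverseʳ _)) ⟩
      base + 0#
        ≈⟨ +-identityʳ base ⟩
      base ∎
      where
      base : Carrier
      base = ⟦ 18 ⟧ * (x * x) - 1# + ⟦ 6 ⟧ * x * (⟦ 2 ⟧ * x - 1#) * s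

    lhs6≈binomialSums : ∀ n → lhs6 n x s ≈ half * (binomialSum n E A T + binomialSum n E B T)
    lhs6≈binomialSums n = begin
      lhs6 n x s
        ≈⟨ sumTo-cong (suc n) (λ k → trans (*-congʳ (*-congʳ (*-congˡ (LB-even (n ∸ k)))))
             (solve 6 (λ c h a b t e → c :* (h :* (a :+ b)) :* t :* e := h :* (c :* a :* t :* e :+ c :* b :* t :* e))
                      refl _ half _ _ _ _)) ⟩
      sumTo (suc n) (λ k → half * (binomialTerm n E A T k + binomialTerm n E B T k))
        ≈⟨ trans (sumTo-*ˡ (suc n) half _) (*-congˡ (sumTo-+ (suc n) _ _)) ⟩
      half * (binomialSum n E A T + binomialSum n E B T) ∎

theorem6 : ∀ {c ℓ : Level} (R : CommutativeRing c ℓ) →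
    let open CommutativeRing R in
    (half : Carrier) → half * (1# + 1#) ≈ 1# →
    (x s : Carrier) →
    s * s ≈ WithRing.⟦_⟧ R half 9 * (x * x) - 1# →
    (n : ℕ) →
    WithRing.lhs6 R half n x s ≈ WithRing.rhs6 R half n x s
theorem6 R half half*two≈1 x s s²≈9x²-1 n = begin
  lhs6 n x s                                                ≈⟨ lhs6≈binomialSums n ⟩
  half * (binomialSum n E A T + binomialSum n E B T)        ≈⟨ *-congˡ (+-congʳ (binomialSum-congᵃ n E T A≈B+T)) ⟩
  half * (binomialSum n E (B + T) T + binomialSum n E B T)  ≈⟨ *-congˡ (binomialSum-Euler half*two≈1 n B T) ⟩
  half * (two * (B + T * x) ^ n)                            ≈⟨ half-cancelˡ _ ⟩
  (B + T * x) ^ n                                           ≈⟨ ^-cong n B+Tx≈base ⟩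
  rhs6 n x s                                                ∎
  where
  open CommutativeRing R
  open WithRing R half
  open Development R half
  open EulerPolynomials x
  open Balancing half*two≈1 x s s²≈9x²-1
  open SetoidReasoning setoid
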